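{- For every $n\ge3$, the cycle $C_n$ is strong $2$-cop-win, and $\lim_{m\to\infty}\operatorname{capt}_2(C_n,m)=\lfloor (n-1)/2\rfloor$.
   Context: All graphs are reflexive. The game of $k$ cops and $m$ robbers: in round $0$ the cops choose starting vertices, then the robbers choose starting vertices (players may share vertices). In each round $i\ge1$ every cop moves to an adjacent vertex or stays, then every robber moves to an adjacent vertex or stays. Whenever a cop occupies the same vertex as some robbers, those robbers are captured and leave the game. For a $k$-cop-win graph $G$ (one on which $k$ cops can always capture one robber), $\operatorname{capt}_k(G,m)$ is the smallest $t$ such that the $k$ cops have a strategy guaranteeing all $m$ robbers are captured by round $t$ regardless of the robbers' play. $G$ is strong $k$-cop-win if $\lim_{m\to\infty}\operatorname{capt}_k(G,m)$ exists (is finite). -}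

module Defs where

open import Data.Nat using (ℕ; zero; suc; _≤_; _<_)
open import Data.Fin using (Fin; toℕ; _≟_)
open import Data.Vec using (Vec; toList)
open import Data.List using (List; []; filter)
open import Data.List.Relation.Unary.Any using (any?)
open import Data.Vec.Relation.Binary.Pointwise.Inductive as VP using ()
open import Data.List.Relation.Binary.Pointwise as LP using ()
open import Data.Product using (Σ; ∃; ∃-syntax; _×_)
open import Data.Sum using (_⊎_)
open import Relation.Nullary using (¬_)
open import Relation.Nullary.Decidable using (¬?)
open import Relation.Binary.PropositionalEquality using (_≡_)

-- A finite reflexive graph on vertex set Fin size.
-- _~_ is the closed-neighbourhood relation ("adjacent or equal").
record Graph : Set₁ where
  field
    size : ℕ
    _~_  : Fin size → Fin size → Set
    refl~ : ∀ v → v ~ v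

open Graph public

CycleAdj : (n : ℕ) → Fin n → Fin n → Set
CycleAdj n u v =
  toℕ u ≡ toℕ v
  ⊎ suc (toℕ u) ≡ toℕ v
  ⊎ suc (toℕ v) ≡ toℕ u
  ⊎ (toℕ u ≡ 0 × suc (toℕ v) ≡ n)
  ⊎ (toℕ v ≡ 0 × suc (toℕ u) ≡ n)

open import Data.Sum using (inj₁)
open import Relation.Binary.PropositionalEquality using (refl)

-- the cycle C_n (meaningful for n ≥ 3)
C : ℕ → Graph
C n = record { size = n ; _~_ = CycleAdj n ; refl~ = λ v → inj₁ refl }

module _ (G : Graph) where
  V : Set
  V = Fin (size G)

  capture : ∀ {k} → Vec V k → List V → List V
  capture cops rs = filter (λ r → ¬? (any? (λ c → r ≟ c) (toList cops))) rs

  CopMove : ∀ {k} → Vec V k → Vec V k → Set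
  CopMove = VP.Pointwise (_~_ G)

  RobMove : List V → List V → Set
  RobMove = LP.Pointwise (_~_ G)

  -- Win t cops rs : from a position at the end of a round (cops at `cops`,
  -- uncaptured robbers at `rs`), the cops can force that all robbers are
  -- captured within t further rounds, whatever the robbers do.
  Win : ∀ {k} → ℕ → Vec V k → List V → Set
  Win zero    cops rs = rs ≡ []
  Win (suc t) cops rs =
    ∃[ cops' ] (CopMove cops cops' ×
      (∀ rs' → RobMove (capture cops' rs) rs' → Win t cops' (capture cops' rs')))

  CanCaptureBy : ℕ → ℕ → ℕ → Set
  CanCaptureBy k m t =
    ∃[ cops ] ∀ (robs : Vec V m) → Win {k} t cops (capture cops (toList robs))

  CopWin : ℕ → Set
  CopWin k = ∃[ t ] CanCaptureBy k 1 t

  IsCapt : ℕ → ℕ → ℕ → Set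
  IsCapt k m t = CanCaptureBy k m t × (∀ t' → t' < t → ¬ CanCaptureBy k m t')

  -- lim_{m→∞} capt_k(G,m) = L  (ℕ-valued, so eventually constant)
  CaptLimit : ℕ → ℕ → Set
  CaptLimit k L = ∃[ M ] ∀ m → M ≤ m → IsCapt k m L

  StrongCopWin : ℕ → Set
  StrongCopWin k = CopWin k × ∃[ L ] CaptLimit k L

{-# OPTIONS --safe #-}
module Submission where

-- Write C_{n+1} as the path 0, 1, …, n closed by the edge n — 0.  Two cops start on the
-- adjacent vertices 0 and n and walk towards each other; a robber strictly between them can
-- never pass a cop, so after ⌊n/2⌋ rounds nobody is left.  Conversely, robbers that never
-- move are caught only by being stepped on; two cops occupy at most 2(t+1) ≤ n vertices
-- during t < ⌊n/2⌋ rounds, so with a robber on every vertex one of them survives.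

open import Defs
open import Data.Nat using (ℕ; _≤_; _∸_; _/_)
open import Data.Product using (_×_)

open import Level using (Level)
open import Data.Nat using (zero; suc; _+_; _*_; _<_; _%_; z≤n; s≤s; s≤s⁻¹)
open import Data.Nat.Properties
  using (≤-trans; ≤-reflexive; <⇒≤; <⇒≱; <-irrefl; ≤∧≢⇒<; ≤-<-trans; <-≤-trans; m≤n+m; m≤m+n;
         n≤1+n; m∸n≤m; +-∸-assoc; m+n∸n≡m; +-suc; +-identityʳ; *-suc; *-identityʳ;
         +-monoˡ-≤; +-monoʳ-≤; *-monoˡ-≤; module ≤-Reasoning)
open import Data.Nat.DivMod using (_mod_; m≡m%n+[m/n]*n; m%n<n; m/n*n≤m; m/n≤m; m≤n⇒m%n≡m)
open import Data.Fin as F using (Fin; toℕ; fromℕ<)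
open import Data.Fin.Properties using (toℕ-injective; toℕ-fromℕ<; toℕ<n; toℕ≤pred[n]; injective⇒≤)
open import Data.Vec using (Vec; []; _∷_; toList; tabulate)
open import Data.Vec.Properties using (length-toList)
open import Data.Vec.Membership.Propositional.Properties using (∈-toList⁺; ∈-tabulate⁺)
open import Data.List as L using (List; []; _∷_; _++_; length)
open import Data.List.Properties using (length-++; filter-idem)
open import Data.List.Relation.Unary.All as All using (All; []; _∷_)
open import Data.List.Relation.Unary.All.Properties using (all-filter; filter⁺)
open import Data.List.Relation.Unary.Any as Any using (here; there; any?)
open import Data.List.Relation.Unary.Any.Properties using (lookup-index)
open import Data.List.Membership.Propositional using (_∈_; _∉_)
open import Data.List.Membership.Propositional.Properties using (∈-filter⁺; ∈-++⁺ˡ; ∈-++⁺ʳ)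
open import Data.List.Relation.Binary.Subset.Propositional using (_⊆_)
import Data.Vec.Relation.Binary.Pointwise.Inductive as VP
import Data.List.Relation.Binary.Pointwise as LP
open import Data.Product using (∃-syntax; _,_)
open import Data.Sum using (inj₁; inj₂)
open import Data.Empty using (⊥-elim)
open import Relation.Nullary using (¬_; yes; no)
open import Relation.Binary.PropositionalEquality
open import Function using (_∘_)

private variable
  a b : Level
  A : Set a

All-map-Pointwise : {R : A → A → Set b} {P Q : A → Set b} →
                    (∀ {x y} → P x → R x y → Q y) →
                    ∀ {xs ys} → All P xs → LP.Pointwise R xs ys → All Q ys
All-map-Pointwise f []       LP.[]       = []
All-map-Pointwise f (p ∷ ps) (r LP.∷ rs) = f p r ∷ All-map-Pointwise f ps rs

length-toList-++ : ∀ {k} (xs : Vec A k) ys → length (toList xs ++ ys) ≡ k + length ys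
length-toList-++ xs ys = trans (length-++ (toList xs)) (cong (_+ length ys) (length-toList xs))

∀∈⇒n≤length : ∀ {n} (xs : List (Fin n)) → (∀ v → v ∈ xs) → n ≤ length xs
∀∈⇒n≤length xs ∈xs = injective⇒≤ index-injective
  where
  index-injective : ∀ {v w} → Any.index (∈xs v) ≡ Any.index (∈xs w) → v ≡ w
  index-injective {v} {w} eq =
    trans (lookup-index (∈xs v)) (trans (cong (L.lookup xs) eq) (sym (lookup-index (∈xs w))))

module _ (G : Graph) where

  All-capture : ∀ {k} {cops : Vec (V G) k} {P Q : V G → Set} →
                (∀ {r} → P r → r ∉ toList cops → Q r) →
                ∀ {rs} → All P rs → All Q (capture G cops rs)
  All-capture f {rs} ps = All.map (λ (p , r∉) → f p r∉) (All.zip (filter⁺ _ ps , all-filter _ rs))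

  capture-idem : ∀ {k} (cops : Vec (V G) k) rs →
                 capture G cops (capture G cops rs) ≡ capture G cops rs
  capture-idem cops = filter-idem _

  capture⊆⇒⊆cops++ : ∀ {k} (cops : Vec (V G) k) {rs ys} →
                     capture G cops rs ⊆ ys → rs ⊆ toList cops ++ ys
  capture⊆⇒⊆cops++ cops survivors⊆ {r} r∈rs with any? (r F.≟_) (toList cops)
  ... | yes r∈cops = ∈-++⁺ˡ r∈cops
  ... | no  r∉cops = ∈-++⁺ʳ (toList cops) (survivors⊆ (∈-filter⁺ _ r∈rs r∉cops))

  -- Robbers who never move are only caught when a cop steps on them.
  Win⇒robbers⊆visited : ∀ {k} t (cops : Vec (V G) k) rs → Win G t cops (capture G cops rs) →
                        ∃[ visited ] length visited ≤ suc t * k × rs ⊆ visited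
  Win⇒robbers⊆visited zero cops rs none-left =
    toList cops ++ [] ,
    ≤-reflexive (length-toList-++ cops []) ,
    capture⊆⇒⊆cops++ cops (subst (_ ∈_) none-left)
  Win⇒robbers⊆visited {k} (suc t) cops rs (cops′ , _ , respond)
    with Win⇒robbers⊆visited t cops′ (capture G cops rs)
           (subst (Win G t cops′) (capture-idem cops′ (capture G cops rs))
             (respond _ (LP.refl (refl~ G _))))
  ... | visited , length≤ , covered =
    toList cops ++ visited ,
    ≤-trans (≤-reflexive (length-toList-++ cops visited)) (+-monoʳ-≤ k length≤) ,
    capture⊆⇒⊆cops++ cops covered

  ¬CanCaptureBy : ∀ {k m} t (robs : Vec (V G) m) → (∀ v → v ∈ toList robs) →
                  suc t * k < size G → ¬ CanCaptureBy G k m t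
  ¬CanCaptureBy t robs everywhere few-visits (cops , wins)
    with Win⇒robbers⊆visited t cops (toList robs) (wins robs)
  ... | visited , length≤ , covered =
    <⇒≱ few-visits (≤-trans (∀∈⇒n≤length visited (λ v → covered (everywhere v))) length≤)

n≤1+[n/2]*2 : ∀ n → n ≤ suc (n / 2 * 2)
n≤1+[n/2]*2 n = begin
  n                 ≡⟨ m≡m%n+[m/n]*n n 2 ⟩
  n % 2 + n / 2 * 2 ≤⟨ +-monoˡ-≤ (n / 2 * 2) (s≤s⁻¹ (m%n<n n 2)) ⟩
  1 + n / 2 * 2     ∎
  where open ≤-Reasoning

-- Here n is the largest vertex of the cycle C (suc n), not its length.
module Cycle (n : ℕ) where

  vertex : ℕ → Fin (suc n)
  vertex i = i mod suc n

  toℕ-vertex : ∀ {i} → i ≤ n → toℕ (vertex i) ≡ i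
  toℕ-vertex i≤n = trans (toℕ-fromℕ< _) (m≤n⇒m%n≡m i≤n)

  cops : ℕ → Vec (Fin (suc n)) 2
  cops t = vertex t ∷ vertex (n ∸ t) ∷ []

  cops-step : ∀ {t} → suc t ≤ n → CopMove (C (suc n)) (cops t) (cops (suc t))
  cops-step {t} t<n =
    inj₂ (inj₁ (trans (cong suc (toℕ-vertex (<⇒≤ t<n))) (sym (toℕ-vertex t<n)))) VP.∷
    inj₂ (inj₂ (inj₁ (begin
      suc (toℕ (vertex (n ∸ suc t))) ≡⟨ cong suc (toℕ-vertex (m∸n≤m n (suc t))) ⟩
      suc (n ∸ suc t)                ≡⟨ +-∸-assoc 1 t<n ⟨
      n ∸ t                          ≡⟨ toℕ-vertex (m∸n≤m n t) ⟨
      toℕ (vertex (n ∸ t))           ∎))) VP.∷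
    VP.[]
    where open ≡-Reasoning

  -- Positions weakly/strictly between the cops at t and n ∸ t, written without subtraction.
  Between Inside : ℕ → ℕ → Set
  Between t i = t ≤ i × i + t ≤ n
  Inside  t i = t < i × i + t < n

  between-0 : (r : Fin (suc n)) → Between 0 (toℕ r)
  between-0 r = z≤n , subst (_≤ n) (sym (+-identityʳ (toℕ r))) (toℕ≤pred[n] r)

  inside⇒between-suc : ∀ {t i} → Inside t i → Between (suc t) i
  inside⇒between-suc {t} {i} (t<i , i+t<n) = t<i , subst (_≤ n) (sym (+-suc i t)) i+t<n

  -- A robber strictly between the cops is not on 0 or n, so cannot use the edge n — 0.
  inside-step : ∀ {t} r r′ → Inside t (toℕ r) → CycleAdj (suc n) r r′ → Between t (toℕ r′)
  inside-step r r′ inside adj with toℕ r | toℕ r′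
  inside-step _ _ (t<i , i+t<n) (inj₁ refl) | i | .i =
    <⇒≤ t<i , <⇒≤ i+t<n
  inside-step _ _ (t<i , i+t<n) (inj₂ (inj₁ refl)) | i | .(suc i) =
    ≤-trans (<⇒≤ t<i) (n≤1+n i) , i+t<n
  inside-step _ _ (t<i , i+t<n) (inj₂ (inj₂ (inj₁ refl))) | .(suc j) | j =
    s≤s⁻¹ t<i , <⇒≤ (<⇒≤ i+t<n)
  inside-step _ _ (() , _) (inj₂ (inj₂ (inj₂ (inj₁ (refl , _))))) | _ | _
  inside-step {t} _ _ (_ , n+t<n) (inj₂ (inj₂ (inj₂ (inj₂ (_ , refl))))) | _ | _ =
    ⊥-elim (<-irrefl refl (≤-<-trans (m≤m+n n t) n+t<n))

  ¬inside : ∀ {t i} → n ≤ suc (t * 2) → ¬ Inside t i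
  ¬inside {t} {i} n≤1+2t (t<i , i+t<n) = <-irrefl refl (begin-strict
    n             ≤⟨ n≤1+2t ⟩
    suc (t * 2)   ≡⟨ cong suc (trans (*-suc t 1) (cong (t +_) (*-identityʳ t))) ⟩
    suc (t + t)   ≤⟨ +-monoˡ-≤ t t<i ⟩
    i + t         <⟨ i+t<n ⟩
    n             ∎)
    where open ≤-Reasoning

  between⇒inside : ∀ {t} → t ≤ n → (r : Fin (suc n)) →
                   Between t (toℕ r) → r ∉ toList (cops t) → Inside t (toℕ r)
  between⇒inside {t} t≤n r (t≤r , r+t≤n) r∉cops =
    ≤∧≢⇒< t≤r (λ t≡r → r∉cops (here (toℕ-injective (trans (sym t≡r) (sym (toℕ-vertex t≤n)))))) ,
    ≤∧≢⇒< r+t≤n (λ r+t≡n → r∉cops (there (here (toℕ-injective (begin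
      toℕ r                ≡⟨ m+n∸n≡m (toℕ r) t ⟨
      toℕ r + t ∸ t        ≡⟨ cong (_∸ t) r+t≡n ⟩
      n ∸ t                ≡⟨ toℕ-vertex (m∸n≤m n t) ⟨
      toℕ (vertex (n ∸ t)) ∎)))))
    where open ≡-Reasoning

  capture-between : ∀ {t} → t ≤ n → ∀ {rs} → All (Between t ∘ toℕ) rs →
                    All (Inside t ∘ toℕ) (capture (C (suc n)) (cops t) rs)
  capture-between t≤n = All-capture (C (suc n)) (λ {r} → between⇒inside t≤n r)

  T : ℕ
  T = n / 2

  closing-in : ∀ k t → k + t ≡ T → ∀ {rs} → All (Inside t ∘ toℕ) rs → Win (C (suc n)) k (cops t) rs
  closing-in zero    _ refl {[]}    _            = refl
  closing-in zero    _ refl {_ ∷ _} (inside ∷ _) = ⊥-elim (¬inside (n≤1+[n/2]*2 n) inside)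
  closing-in (suc k) t k+t≡T insides =
    cops (suc t) , cops-step t<n , λ _ moved →
      closing-in k (suc t) (trans (+-suc k t) k+t≡T)
        (capture-between t<n (All-map-Pointwise (λ {r} {r′} → inside-step r r′)
          (capture-between t<n (All.map inside⇒between-suc insides)) moved))
    where
    t<n : suc t ≤ n
    t<n = ≤-trans (s≤s (m≤n+m t k)) (≤-trans (≤-reflexive k+t≡T) (m/n≤m n 2))

  capture-by-T : ∀ m → CanCaptureBy (C (suc n)) 2 m T
  capture-by-T m = cops 0 , λ robs →
    closing-in T 0 (+-identityʳ T) (capture-between z≤n (All.universal between-0 (toList robs)))

  cyclicPlacement : ∀ m → Vec (Fin (suc n)) m
  cyclicPlacement m = tabulate (λ i → vertex (toℕ i))

  ∈-cyclicPlacement : ∀ {m} → suc n ≤ m → ∀ v → v ∈ toList (cyclicPlacement m)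
  ∈-cyclicPlacement {m} n<m v =
    subst (_∈ toList (cyclicPlacement m)) (toℕ-injective toℕ-vertex-i≡v) (∈-toList⁺ (∈-tabulate⁺ _ i))
    where
    v<m : toℕ v < m
    v<m = <-≤-trans (toℕ<n v) n<m
    i : Fin m
    i = fromℕ< v<m
    toℕ-vertex-i≡v : toℕ (vertex (toℕ i)) ≡ toℕ v
    toℕ-vertex-i≡v = trans (cong (toℕ ∘ vertex) (toℕ-fromℕ< v<m)) (toℕ-vertex (toℕ≤pred[n] v))

  no-capture-before-T : ∀ {m t} → suc n ≤ m → t < T → ¬ CanCaptureBy (C (suc n)) 2 m t
  no-capture-before-T {m} {t} n<m t<T =
    ¬CanCaptureBy (C (suc n)) t (cyclicPlacement m) (∈-cyclicPlacement n<m)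
      (s≤s (≤-trans (*-monoˡ-≤ 2 t<T) (m/n*n≤m n 2)))

  capt-limit : CaptLimit (C (suc n)) 2 T
  capt-limit = suc n , λ m n<m → capture-by-T m , λ t t<T → no-capture-before-T n<m t<T

proposition4p4 : ∀ (n : ℕ) → 3 ≤ n →
    StrongCopWin (C n) 2 × CaptLimit (C n) 2 ((n ∸ 1) / 2)
proposition4p4 (suc n) _ = ((T , capture-by-T 1) , T , capt-limit) , capt-limit
  where open Cycle n
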